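{- Let \[ M = \begin{pmatrix} 0 & 2 & 2 & 1 & 1 & 1 \\ 2 & 0 & 2 & 1 & 1 & 1 \\ 2 & 2 & 0 & 1 & 1 & 1 \\ 1 & 1 & 1 & 0 & 1 & 1 \\ 1 & 1 & 1 & 1 & 0 & 1 \\ 1 & 1 & 1 & 1 & 1 & 0 \end{pmatrix}, \] the distance matrix of $K_6\setminus K_3$ (the complete graph on $6$ vertices with the three edges of a triangle removed), with the three vertices of degree $3$ labelled $1,2,3$ and the three vertices of degree $5$ labelled $4,5,6$. Then for every $w\in\mathbb{Z}^6$ with $\sum_i w_i=0$, the vector $Mw$, after sorting its coordinates, is never an arithmetic progression with nonzero common difference. Moreover, there exists $w\in\mathbb{Z}^6$ such that $Mw = (0,4,6,2,3,5)^T$. -}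

module Defs where

open import Data.Nat using (ℕ)
open import Data.Fin using (Fin; zero; suc; toℕ)
open import Data.Fin.Permutation using (Permutation′; _⟨$⟩ʳ_)
open import Data.Integer using (ℤ; +_; _+_; _*_; 0ℤ)
open import Data.Product using (Σ; _×_; ∃)
open import Relation.Binary.PropositionalEquality using (_≡_; _≢_)

Vec6 : Set
Vec6 = Fin 6 → ℤ

sumFin : ∀ {n} → (Fin n → ℤ) → ℤ
sumFin {ℕ.zero} f = 0ℤ
sumFin {ℕ.suc n} f = f zero + sumFin (λ i → f (suc i))

-- Distance matrix of K6 \ K3; vertices 0,1,2 (paper's 1,2,3) are the
-- degree-3 vertices (pairwise distance 2), vertices 3,4,5 have degree 5.
M : Fin 6 → Fin 6 → ℤ
M i j with toℕ i | toℕ j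
... | a | b = entry a b
  where
  entry : ℕ → ℕ → ℤ
  entry 0 0 = + 0
  entry 1 1 = + 0
  entry 2 2 = + 0
  entry 3 3 = + 0
  entry 4 4 = + 0
  entry 5 5 = + 0
  entry 0 1 = + 2
  entry 0 2 = + 2
  entry 1 0 = + 2
  entry 1 2 = + 2
  entry 2 0 = + 2
  entry 2 1 = + 2
  entry _ _ = + 1

mulM : Vec6 → Vec6
mulM w i = sumFin (λ j → M i j * w j)

IsNonconstantAPAfterSorting : Vec6 → Set
IsNonconstantAPAfterSorting v =
  Σ (Permutation′ 6) λ σ → Σ ℤ λ a → Σ ℤ λ d →
    (d ≢ 0ℤ) × (∀ (k : Fin 6) → v (σ ⟨$⟩ʳ k) ≡ a + (+ toℕ k) * d)

target : Vec6
target zero = + 0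
target (suc zero) = + 4
target (suc (suc zero)) = + 6
target (suc (suc (suc zero))) = + 2
target (suc (suc (suc (suc zero)))) = + 3
target (suc (suc (suc (suc (suc zero))))) = + 5

-- Write v = M w. For Σ w = 0 the three degree-3 coordinates of v carry exactly half of Σ v,
-- i.e. 2 (v₀ + v₁ + v₂) = Σ v. If v were a rearrangement of a, a + d, …, a + 5d, then
-- Σ v = 6a + 15d, while 2 (v₀ + v₁ + v₂) = 6a + 2Kd with K the sum of three positions;
-- so 2K d = 15 d, which is impossible for d ≠ 0 since 15 is odd.
module Submission where

open import Defs
open import Data.Integer using (0ℤ)
open import Data.Product using (_×_; Σ; _,_)
open import Relation.Nullary using (¬_)
open import Relation.Binary.PropositionalEquality using (_≡_)

open import Data.Fin using (Fin; toℕ)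
open import Data.Fin.Patterns using (0F; 1F; 2F; 3F; 4F; 5F)
open import Data.Fin.Permutation using (Permutation′; _⟨$⟩ʳ_; _⟨$⟩ˡ_; inverseʳ)
open import Data.Integer using (ℤ; +_; -_; _+_; _*_; ≢-nonZero)
import Data.Integer.Properties as ℤ
open import Data.Integer.Tactic.RingSolver using (solve-∀)
open import Data.Nat as ℕ using (ℕ)
open import Data.Nat.Properties using (even≢odd)
open import Relation.Binary.PropositionalEquality using (refl; sym; trans; cong; cong₂; module ≡-Reasoning)

open import Algebra.Properties.AbelianGroup ℤ.+-0-abelianGroup using (∙-cancelˡ)
open import Algebra.Properties.CommutativeMonoid.Sum ℤ.+-0-commutativeMonoid using (sum-permute)

-- The ring solver does not unfold definitions, so this identity and  sum-arithmetic-progression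
-- are stated in the normal forms of  mulM  and  sumFin  and then applied by conversion.
twice-degree3-rows : ∀ x₀ x₁ x₂ x₃ x₄ x₅ →
  let row : ℤ → ℤ → ℤ → ℤ → ℤ → ℤ → ℤ
      row c₀ c₁ c₂ c₃ c₄ c₅ = c₀ * x₀ + (c₁ * x₁ + (c₂ * x₂ + (c₃ * x₃ + (c₄ * x₄ + (c₅ * x₅ + + 0)))))
      r₀ = row (+ 0) (+ 2) (+ 2) (+ 1) (+ 1) (+ 1)
      r₁ = row (+ 2) (+ 0) (+ 2) (+ 1) (+ 1) (+ 1)
      r₂ = row (+ 2) (+ 2) (+ 0) (+ 1) (+ 1) (+ 1)
      r₃ = row (+ 1) (+ 1) (+ 1) (+ 0) (+ 1) (+ 1)
      r₄ = row (+ 1) (+ 1) (+ 1) (+ 1) (+ 0) (+ 1)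
      r₅ = row (+ 1) (+ 1) (+ 1) (+ 1) (+ 1) (+ 0)
  in + 2 * (r₀ + (r₁ + r₂))
       ≡ (r₀ + (r₁ + (r₂ + (r₃ + (r₄ + (r₅ + + 0))))))
         + (x₀ + (x₁ + (x₂ + (x₃ + (x₄ + (x₅ + + 0))))))
twice-degree3-rows = solve-∀

twice-degree3-sum-mulM : ∀ w → sumFin w ≡ 0ℤ →
  + 2 * (mulM w 0F + (mulM w 1F + mulM w 2F)) ≡ sumFin (mulM w)
twice-degree3-sum-mulM w Σw≡0 = begin
  + 2 * (mulM w 0F + (mulM w 1F + mulM w 2F))
    ≡⟨ twice-degree3-rows (w 0F) (w 1F) (w 2F) (w 3F) (w 4F) (w 5F) ⟩
  sumFin (mulM w) + sumFin w ≡⟨ cong (λ s → sumFin (mulM w) + s) Σw≡0 ⟩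
  sumFin (mulM w) + 0ℤ       ≡⟨ ℤ.+-identityʳ _ ⟩
  sumFin (mulM w)            ∎
  where open ≡-Reasoning

sum-arithmetic-progression : ∀ a d →
  (a + + 0 * d) + ((a + + 1 * d) + ((a + + 2 * d) + ((a + + 3 * d) + ((a + + 4 * d) + ((a + + 5 * d) + + 0)))))
    ≡ + 6 * a + + 15 * d
sum-arithmetic-progression = solve-∀

sum-permuted-arithmetic-progression : ∀ (v : Vec6) (σ : Permutation′ 6) a d →
  (∀ k → v (σ ⟨$⟩ʳ k) ≡ a + + toℕ k * d) → sumFin v ≡ + 6 * a + + 15 * d
sum-permuted-arithmetic-progression v σ a d ap = begin
  sumFin v                           ≡⟨ sum-permute v σ ⟩
  sumFin (λ k → v (σ ⟨$⟩ʳ k))        ≡⟨ cong₂ _+_ (ap 0F) (cong₂ _+_ (ap 1F) (cong₂ _+_ (ap 2F)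
                                          (cong₂ _+_ (ap 3F) (cong₂ _+_ (ap 4F) (cong₂ _+_ (ap 5F) refl))))) ⟩
  sumFin {6} (λ k → a + + toℕ k * d) ≡⟨ sum-arithmetic-progression a d ⟩
  + 6 * a + + 15 * d                 ∎
  where open ≡-Reasoning

twice-sum-of-three-terms : ∀ a d x y z →
  + 2 * ((a + + x * d) + ((a + + y * d) + (a + + z * d)))
    ≡ + 6 * a + + (2 ℕ.* (x ℕ.+ (y ℕ.+ z))) * d
twice-sum-of-three-terms a d x y z = begin
  + 2 * ((a + + x * d) + ((a + + y * d) + (a + + z * d)))
    ≡⟨ identity a d (+ x) (+ y) (+ z) ⟩
  + 6 * a + + 2 * (+ x + (+ y + + z)) * d
    ≡⟨ cong (λ c → + 6 * a + c * d) coefficient ⟨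
  + 6 * a + + (2 ℕ.* (x ℕ.+ (y ℕ.+ z))) * d ∎
  where
  open ≡-Reasoning
  identity : ∀ a d x y z → + 2 * ((a + x * d) + ((a + y * d) + (a + z * d)))
                          ≡ + 6 * a + + 2 * (x + (y + z)) * d
  identity = solve-∀
  coefficient : + (2 ℕ.* (x ℕ.+ (y ℕ.+ z))) ≡ + 2 * (+ x + (+ y + + z))
  coefficient = trans (ℤ.pos-* 2 (x ℕ.+ (y ℕ.+ z)))
    (cong (λ s → + 2 * s) (trans (ℤ.pos-+ x (y ℕ.+ z)) (cong (λ s → + x + s) (ℤ.pos-+ y z))))

mulM-not-arithmetic-progression : ∀ w → sumFin w ≡ 0ℤ → ¬ IsNonconstantAPAfterSorting (mulM w)
mulM-not-arithmetic-progression w Σw≡0 (σ , a , d , d≢0 , ap) =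
  even≢odd K 7 (ℤ.+-injective (ℤ.*-cancelʳ-≡ _ _ d {{≢-nonZero d≢0}}
    (∙-cancelˡ (+ 6 * a) _ _ six-a+2K·d≡six-a+15·d)))
  where
  v : Vec6
  v = mulM w
  position : Fin 6 → ℕ
  position i = toℕ (σ ⟨$⟩ˡ i)
  K : ℕ
  K = position 0F ℕ.+ (position 1F ℕ.+ position 2F)
  v≡term : ∀ i → v i ≡ a + + position i * d
  v≡term i = trans (cong v (sym (inverseʳ σ))) (ap (σ ⟨$⟩ˡ i))
  open ≡-Reasoning
  six-a+2K·d≡six-a+15·d : + 6 * a + + (2 ℕ.* K) * d ≡ + 6 * a + + 15 * d
  six-a+2K·d≡six-a+15·d = begin
    + 6 * a + + (2 ℕ.* K) * d
      ≡⟨ twice-sum-of-three-terms a d (position 0F) (position 1F) (position 2F) ⟨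
    + 2 * ((a + + position 0F * d) + ((a + + position 1F * d) + (a + + position 2F * d)))
      ≡⟨ cong (λ s → + 2 * s) (cong₂ _+_ (v≡term 0F) (cong₂ _+_ (v≡term 1F) (v≡term 2F))) ⟨
    + 2 * (v 0F + (v 1F + v 2F))   ≡⟨ twice-degree3-sum-mulM w Σw≡0 ⟩
    sumFin v                       ≡⟨ sum-permuted-arithmetic-progression v σ a d ap ⟩
    + 6 * a + + 15 * d             ∎

target-preimage : Vec6
target-preimage 0F = + 5
target-preimage 1F = + 3
target-preimage 2F = + 2
target-preimage 3F = - + 2
target-preimage 4F = - + 3
target-preimage 5F = - + 5

mulM-target-preimage : ∀ i → mulM target-preimage i ≡ target i
mulM-target-preimage 0F = refl
mulM-target-preimage 1F = refl
mulM-target-preimage 2F = refl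
mulM-target-preimage 3F = refl
mulM-target-preimage 4F = refl
mulM-target-preimage 5F = refl

propositionA1 : ((w : Vec6) → sumFin w ≡ 0ℤ → ¬ IsNonconstantAPAfterSorting (mulM w))
    × Σ Vec6 (λ w → ∀ i → mulM w i ≡ target i)
propositionA1 = mulM-not-arithmetic-progression , (target-preimage , mulM-target-preimage)
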